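{- Let $P$ be a set of ports and $X=P\cup\dot P\cup\overline P$. Every causal interaction tree $t$ over $X$ can be represented by a system of causal rules having only firing ports (or $\mathtt{tt}$) as effects, i.e. there is a set of rules $\{\dot p\Rightarrow C_{\dot p}\}_{p\in P}\cup\{\mathtt{tt}\Rightarrow C_{\mathtt{tt}}\}$, each $C$ being a DNF Boolean formula on $\dot P\cup P$ without negative firing variables, such that the set $\gamma_R$ of interactions satisfying this system is $\sim$-equivalent to $t$, that is $\gamma_R(B_1,\dots,B_n)=\|t\|(B_1,\dots,B_n)$ for every finite family of behaviours.
   Context: $\dot P=\{\dot p:p\in P\}$ (firing typings/variables), $P$ (activation typings/variables), $\overline P=\{\overline p:p\in P\}$ (negative typings); a negative typing $\overline p$ is read as the negation of the activation variable $p$. For $a\subseteq X$, $\dot{\mathrm{sup}}(a)=\{p:\dot p\in a\}$, $\overline{\mathrm{sup}}(a)=\{p:\overline p\in a\}$. Causal interaction trees over $X$: $t::=a\mid a\rightarrow t\mid t\oplus t$, nodes $a\subseteq X$ (empty interaction $1$) or $0$; semantics $\|0\|=\emptyset$, $\|a\|=\{a\}$, $\|a\rightarrow t\|=\{a\}\cup\{a\cup b:b\in\|t\|\}$, $\|t_1\oplus t_2\|=\|t_1\|\cup\|t_2\|\cup\{b_1\cup b_2:b_i\in\|t_i\|\}$. A causal rule is a formula $E\Rightarrow C$ with effect $E$ either $\mathtt{tt}$ or a variable, and cause $C$ either $\mathtt{tt}$, $\mathtt{ff}$, or a DNF formula not containing $E$. An interaction $a\subseteq X$ satisfies a system of causal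 rules iff its characteristic valuation (a variable is true iff it belongs to $a$) satisfies the conjunction of all the rules; the system is additionally subject to the axiom $\dot p\Rightarrow p$ for all $p\in P$. Behaviours and composition: a behaviour is $B=(Q,P,\to,\rightsquigarrow)$ with $\to\subseteq Q\times2^P\times Q$, $q\xrightarrow{\emptyset}q$ for all $q$, and offer predicate $\rightsquigarrow\subseteq Q\times P$ with $q\rightsquigarrow p$ whenever $q\xrightarrow{a}$ for some $a\ni p$. For behaviours $B_i$ with pairwise disjoint port sets $P_i$, $\bigcup P_i=P$, and $\gamma\subseteq2^X$, $\gamma(B_1,\dots,B_n)$ has states $\prod Q_i$, offer $q_1\dots q_n\rightsquigarrow p$ iff some $q_i\rightsquigarrow p$, and the least transition relation with $q_1\dots q_n\xrightarrow{\dot{\mathrm{sup}}(a)}q_1'\dots q_n'$ whenever $a\in\gamma$ and for all $i$: $q_i\xrightarrow{\dot{\mathrm{sup}}(a)\cap P_i}q_i'$, $q_i\rightsquigarrow p$ for all $p\in a\cap P\cap P_i$, $q_i\not\rightsquigarrow p$ for all $p\in\overline{\mathrm{sup}}(a)\cap P_i$. -}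

module Defs where

open import Data.Nat using (ℕ)
open import Data.Fin using (Fin; _≟_)
open import Data.Fin.Subset using (Subset; _∈_; _∩_; _∪_; ⊥)
open import Data.Bool using (Bool; true; false)
open import Data.Maybe using (Maybe; just; nothing)
open import Data.List using (List)
open import Data.List.Relation.Unary.All using (All)
open import Data.List.Relation.Unary.Any using (Any)
open import Data.Product using (Σ; _×_)
open import Data.Vec using (tabulate)
open import Data.Empty using () renaming (⊥ to Empty)
open import Relation.Nullary using (¬_)
open import Relation.Nullary.Decidable using (⌊_⌋)
open import Relation.Binary.PropositionalEquality using (_≡_)

-- Ports P = Fin n.
-- An interaction a ⊆ X is given by its three parts:
--   fir a = sup-dot(a) ⊆ P   (firing typings ṗ ∈ a)
--   act a = a ∩ P            (activation typings p ∈ a)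
--   neg a = sup-bar(a) ⊆ P   (negative typings p̄ ∈ a)

record Interaction (n : ℕ) : Set where
  constructor ⟨_,_,_⟩
  field
    fir : Subset n
    act : Subset n
    neg : Subset n
open Interaction public

_∪ᵢ_ : ∀ {n} → Interaction n → Interaction n → Interaction n
a ∪ᵢ b = ⟨ fir a ∪ fir b , act a ∪ act b , neg a ∪ neg b ⟩

InteractionSet : ℕ → Set₁
InteractionSet n = Interaction n → Set

-- Causal interaction trees:  t ::= a | a → t | t ⊕ t,
-- nodes are interactions a ⊆ X or 0 (represented by nothing).

data Tree (n : ℕ) : Set where
  leaf  : Maybe (Interaction n) → Tree n
  _⇒_   : Maybe (Interaction n) → Tree n → Tree n
  _⊕_   : Tree n → Tree n → Tree n

NodeSem : ∀ {n} → Maybe (Interaction n) → Interaction n → Set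
NodeSem (just a) b = b ≡ a
NodeSem nothing  b = Empty

data _∈⟦_⟧ {n : ℕ} : Interaction n → Tree n → Set where
  leaf   : ∀ {x b} → NodeSem x b → b ∈⟦ leaf x ⟧
  arr₁   : ∀ {x t b} → NodeSem x b → b ∈⟦ x ⇒ t ⟧
  arr₂   : ∀ {x t a c b} → NodeSem x a → c ∈⟦ t ⟧ → b ≡ a ∪ᵢ c → b ∈⟦ x ⇒ t ⟧
  plusˡ  : ∀ {t₁ t₂ b} → b ∈⟦ t₁ ⟧ → b ∈⟦ t₁ ⊕ t₂ ⟧
  plusʳ  : ∀ {t₁ t₂ b} → b ∈⟦ t₂ ⟧ → b ∈⟦ t₁ ⊕ t₂ ⟧
  plus   : ∀ {t₁ t₂ b₁ b₂ b} → b₁ ∈⟦ t₁ ⟧ → b₂ ∈⟦ t₂ ⟧ → b ≡ b₁ ∪ᵢ b₂ → b ∈⟦ t₁ ⊕ t₂ ⟧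

⟦_⟧ : ∀ {n} → Tree n → InteractionSet n
⟦ t ⟧ b = b ∈⟦ t ⟧

-- Causal rules with DNF causes on Ṗ ∪ P without negative firing
-- variables.  Literals: ṗ, p, and ¬p (= the negative typing p̄).

data Literal (n : ℕ) : Set where
  fire : Fin n → Literal n
  actv : Fin n → Literal n
  nega : Fin n → Literal n

Holds : ∀ {n} → Interaction n → Literal n → Set
Holds a (fire p) = p ∈ fir a
Holds a (actv p) = p ∈ act a
Holds a (nega p) = p ∈ neg a

-- DNF: disjunction (list) of conjunctions (lists) of literals.
-- (tt = [ [] ], ff = [])
DNF : ℕ → Set
DNF n = List (List (Literal n))

SatDNF : ∀ {n} → Interaction n → DNF n → Set
SatDNF a C = Any (All (Holds a)) C

-- γ_R for the system {ṗ ⇒ C ṗ}_p ∪ {tt ⇒ Ctt}, plus the axioms ṗ ⇒ p.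
γR : ∀ {n} → (Fin n → DNF n) → DNF n → InteractionSet n
γR Cf Ctt a =
  (∀ p → p ∈ fir a → SatDNF a (Cf p)) ×
  SatDNF a Ctt ×
  (∀ p → p ∈ fir a → p ∈ act a)

DoesNotContain : ∀ {n} → Literal n → DNF n → Set
DoesNotContain l C = All (All (λ l′ → ¬ (l′ ≡ l))) C

-- Behaviours.  A finite family of m behaviours with pairwise disjoint
-- port sets covering P is given by an ownership map own : Fin n → Fin m
-- (P_k = {p | own p ≡ k}).

Ports : ∀ {n m} → (Fin n → Fin m) → Fin m → Subset n
Ports own k = tabulate (λ p → ⌊ own p ≟ k ⌋)

record Behaviour {m : ℕ} (n : ℕ) (own : Fin n → Fin m) (k : Fin m) : Set₁ where
  field
    Q      : Set
    Step   : Q → Subset n → Q → Set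
    Offers : Q → Fin n → Set
    step-ports  : ∀ {q a q′} → Step q a q′ → ∀ p → p ∈ a → own p ≡ k
    offer-ports : ∀ {q p} → Offers q p → own p ≡ k
    idle        : ∀ q → Step q ⊥ q
    offer-step  : ∀ {q a q′} → Step q a q′ → ∀ p → p ∈ a → Offers q p
open Behaviour public

Family : (n m : ℕ) → (Fin n → Fin m) → Set₁
Family n m own = (k : Fin m) → Behaviour n own k

State : ∀ {n m own} → Family n m own → Set
State B = ∀ k → Q (B k)

CompOffers : ∀ {n m own} (B : Family n m own) → State B → Fin n → Set
CompOffers {m = m} B q p = Σ (Fin m) λ k → Offers (B k) (q k) p

-- Transition relation of γ(B_1,…,B_m) (the least relation closed under
-- the composition rule is exactly the set of its instances).
CompStep : ∀ {n m own} → InteractionSet n → (B : Family n m own) →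
           State B → Subset n → State B → Set
CompStep {n} {m} {own} γ B q A q′ =
  Σ (Interaction n) λ a →
    γ a × fir a ≡ A ×
    (∀ k → Step (B k) (q k) (fir a ∩ Ports own k) (q′ k)
         × (∀ p → p ∈ act a → own p ≡ k → Offers (B k) (q k) p)
         × (∀ p → p ∈ neg a → own p ≡ k → ¬ Offers (B k) (q k) p))

-- γ₁ ∼ γ₂ : γ₁(B) = γ₂(B) for every finite family of behaviours.
-- States and offers coincide definitionally; transitions must coincide.
_∼_ : ∀ {n} → InteractionSet n → InteractionSet n → Set₁
_∼_ {n} γ₁ γ₂ = ∀ m (own : Fin n → Fin m) (B : Family n m own) →
  ∀ q A q′ → (CompStep γ₁ B q A q′ → CompStep γ₂ B q A q′)
           × (CompStep γ₂ B q A q′ → CompStep γ₁ B q A q′)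

-- The semantics ‖t‖ of a tree is a finite set of interactions closed under union.  Take as
-- C_tt the disjunction, over a ∈ ‖t‖, of the conjunction of the variables of a, and as C_ṗ
-- the same disjunction restricted to the a containing ṗ, with ṗ itself dropped.  An
-- interaction b satisfying the rules then lies above some a ∈ ‖t‖, and every ṗ ∈ b lies in
-- some a ∈ ‖t‖ below b; the union of all these is an element u of ‖t‖ below b firing exactly
-- the ports fired by b, so every composite step labelled b is also a step labelled u.
-- Conversely a ∈ ‖t‖ with the activations of its fired ports added satisfies the rules and
-- labels the same steps as a, because a port fired by a component is offered by it.
module Submission where

open import Defs
open import Level using (0ℓ)
open import Algebra.Bundles using (CommutativeSemigroup)
open import Algebra.Structures using (IsCommutativeSemigroup)
import Algebra.Properties.CommutativeSemigroup as CommutativeSemigroupProperties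
open import Data.Nat using (ℕ)
open import Data.Fin using (Fin; _≟_)
open import Data.Fin.Subset using (Subset; _∈_; _∉_; _∩_; _∪_; _⊆_; ∁; ⁅_⁆)
open import Data.Fin.Subset.Properties
  using (∪-assoc; ∪-comm; ∪-idem; ⊆-antisym; x∈p∪q⁻; x∈p∪q⁺; x∈p∩q⁺; x∈p∩q⁻; p∩q⊆p;
         x∈⁅x⁆; x∈p⇒x∉∁p; x∉p⇒x∈∁p; x≢y⇒x∉⁅y⁆; _∈?_)
open import Data.List using (List; []; _∷_; _++_; map; filter; cartesianProductWith; allFin)
open import Data.List.Relation.Unary.All as All using (All; []; _∷_)
open import Data.List.Relation.Unary.All.Properties as All using (++⁺; ++⁻)
open import Data.List.Relation.Unary.Any as Any using (here; there)
open import Data.List.Relation.Unary.Any.Properties as Any using ()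
open import Data.List.Membership.Propositional using (find; lose) renaming (_∈_ to _∈ₗ_)
open import Data.List.Membership.Propositional.Properties
  using (∈-map⁺; ∈-map⁻; ∈-++⁺ˡ; ∈-++⁺ʳ; ∈-++⁻; ∈-cartesianProductWith⁺;
         ∈-cartesianProductWith⁻; ∈-allFin; ∈-filter⁺; ∈-filter⁻)
open import Data.Maybe using (just; nothing)
open import Data.Product using (Σ; _×_; _,_; proj₂; ∃-syntax)
open import Data.Sum using (inj₁; inj₂; [_,_]′)
open import Data.Vec.Properties using (lookup⇒[]=; lookup∘tabulate)
open import Relation.Nullary using (yes; no; contradiction)
open import Relation.Nullary.Decidable using (dec-true; isYes≗does)
open import Relation.Binary.PropositionalEquality
  using (_≡_; _≢_; refl; sym; trans; cong; subst)
open import Relation.Binary.PropositionalEquality.Algebra using (isMagma)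

private
  variable
    n m : ℕ
    a b c : Interaction n

∪-⊆ : {s t u : Subset n} → s ⊆ u → t ⊆ u → s ∪ t ⊆ u
∪-⊆ {s = s} {t} s⊆u t⊆u x∈s∪t = [ s⊆u , t⊆u ]′ (x∈p∪q⁻ s t x∈s∪t)

∈-Ports : (own : Fin n → Fin m) {p : Fin n} {k : Fin m} → own p ≡ k → p ∈ Ports own k
∈-Ports own {p} {k} own≡k =
  lookup⇒[]= p _ (trans (lookup∘tabulate _ p)
                  (trans (isYes≗does (own p ≟ k)) (dec-true (own p ≟ k) own≡k)))

Interaction-≡ : ∀ {s t u s′ t′ u′ : Subset n} →
        s ≡ s′ → t ≡ t′ → u ≡ u′ → ⟨ s , t , u ⟩ ≡ ⟨ s′ , t′ , u′ ⟩
Interaction-≡ refl refl refl = refl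

∪ᵢ-isCommutativeSemigroup : IsCommutativeSemigroup {A = Interaction n} _≡_ _∪ᵢ_
∪ᵢ-isCommutativeSemigroup = record
  { isSemigroup = record
    { isMagma = isMagma _∪ᵢ_
    ; assoc   = λ a b c → Interaction-≡ (∪-assoc _ _ _) (∪-assoc _ _ _) (∪-assoc _ _ _)
    }
  ; comm = λ a b → Interaction-≡ (∪-comm _ _) (∪-comm _ _) (∪-comm _ _)
  }

∪ᵢ-commutativeSemigroup : ℕ → CommutativeSemigroup 0ℓ 0ℓ
∪ᵢ-commutativeSemigroup n = record { isCommutativeSemigroup = ∪ᵢ-isCommutativeSemigroup {n} }

∪ᵢ-idem : (a : Interaction n) → a ∪ᵢ a ≡ a
∪ᵢ-idem a = Interaction-≡ (∪-idem _) (∪-idem _) (∪-idem _)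

infix 4 _≤ᵢ_

record _≤ᵢ_ (a b : Interaction n) : Set where
  field
    fir-⊆ : fir a ⊆ fir b
    act-⊆ : act a ⊆ act b
    neg-⊆ : neg a ⊆ neg b
open _≤ᵢ_

∪ᵢ-lub : a ≤ᵢ c → b ≤ᵢ c → a ∪ᵢ b ≤ᵢ c
∪ᵢ-lub a≤c b≤c = record
  { fir-⊆ = ∪-⊆ (fir-⊆ a≤c) (fir-⊆ b≤c)
  ; act-⊆ = ∪-⊆ (act-⊆ a≤c) (act-⊆ b≤c)
  ; neg-⊆ = ∪-⊆ (neg-⊆ a≤c) (neg-⊆ b≤c)
  }

module _ {S : InteractionSet n} (S-∪ᵢ : ∀ {a c} → S a → S c → S (a ∪ᵢ c)) {b : Interaction n}
         (below : ∃[ a ] S a × a ≤ᵢ b)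
         (firedBelow : ∀ {p} → p ∈ fir b → ∃[ a ] S a × a ≤ᵢ b × p ∈ fir a) where

  private
    coverPorts : (ps : List (Fin n)) →
                 ∃[ u ] S u × u ≤ᵢ b × (∀ {p} → p ∈ₗ ps → p ∈ fir b → p ∈ fir u)
    coverPorts [] = let a , Sa , a≤b = below in a , Sa , a≤b , λ ()
    coverPorts (p ∷ ps) with coverPorts ps | p ∈? fir b
    ... | u , Su , u≤b , covered | no p∉b =
      u , Su , u≤b , λ { (here refl) p∈b → contradiction p∈b p∉b ; (there r∈) → covered r∈ }
    ... | u , Su , u≤b , covered | yes p∈b =
      let a , Sa , a≤b , p∈a = firedBelow p∈b in
      u ∪ᵢ a , S-∪ᵢ Su Sa , ∪ᵢ-lub u≤b a≤b ,
      λ { (here refl) _ → x∈p∪q⁺ (inj₂ p∈a) ; (there r∈) r∈b → x∈p∪q⁺ (inj₁ (covered r∈ r∈b)) }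

  firingCover : ∃[ u ] S u × u ≤ᵢ b × fir u ≡ fir b
  firingCover =
    let u , Su , u≤b , covered = coverPorts (allFin n)
    in u , Su , u≤b , ⊆-antisym (fir-⊆ u≤b) (covered (∈-allFin _))

-- b ⊑ a: every composite step labelled a is also labelled b.  The activations of the
-- ports fired by a need not be demanded explicitly: a component offers every port it fires.
infix 4 _⊑_

record _⊑_ (b a : Interaction n) : Set where
  field
    ⊑-fir : fir b ≡ fir a
    ⊑-act : act b ⊆ act a ∪ fir a
    ⊑-neg : neg b ⊆ neg a
open _⊑_

offers-fired : {own : Fin n → Fin m} {k : Fin m} (Bₖ : Behaviour n own k) {q q′ : Q Bₖ}
               {s : Subset n} {p : Fin n} →
               Step Bₖ q (s ∩ Ports own k) q′ → p ∈ s → own p ≡ k → Offers Bₖ q p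
offers-fired {own = own} Bₖ step p∈s own≡k =
  offer-step Bₖ step _ (x∈p∩q⁺ (p∈s , ∈-Ports own own≡k))

CompStep-⊑ : {γ₁ γ₂ : InteractionSet n} {own : Fin n → Fin m} (B : Family n m own) →
             (∀ {a} → γ₁ a → ∃[ b ] γ₂ b × b ⊑ a) →
             ∀ {q A q′} → CompStep γ₁ B q A q′ → CompStep γ₂ B q A q′
CompStep-⊑ {own = own} B replay {q} {q′ = q′} (a , γ₁a , refl , steps) =
  let b , γ₂b , b⊑a = replay γ₁a in
  b , γ₂b , ⊑-fir b⊑a , λ k →
    let step , offered , refused = steps k in
    subst (λ s → Step (B k) (q k) (s ∩ Ports own k) (q′ k)) (sym (⊑-fir b⊑a)) step ,
    (λ p p∈b own≡k → [ (λ p∈a → offered p p∈a own≡k)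
                     , (λ p∈a → offers-fired (B k) step p∈a own≡k) ]′
                     (x∈p∪q⁻ (act a) (fir a) (⊑-act b⊑a p∈b))) ,
    (λ p p∈b → refused p (⊑-neg b⊑a p∈b))

∼-⊑ : {γ₁ γ₂ : InteractionSet n} →
      (∀ {a} → γ₁ a → ∃[ b ] γ₂ b × b ⊑ a) → (∀ {a} → γ₂ a → ∃[ b ] γ₁ b × b ⊑ a) → γ₁ ∼ γ₂
∼-⊑ replay₁ replay₂ m own B q A q′ = CompStep-⊑ B replay₁ , CompStep-⊑ B replay₂

≤ᵢ-⊑ : a ≤ᵢ b → fir a ≡ fir b → a ⊑ b
≤ᵢ-⊑ a≤b fir≡ = record
  { ⊑-fir = fir≡
  ; ⊑-act = λ p∈ → x∈p∪q⁺ (inj₁ (act-⊆ a≤b p∈))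
  ; ⊑-neg = neg-⊆ a≤b
  }

activateFiring : Interaction n → Interaction n
activateFiring a = record a { act = act a ∪ fir a }

activateFiring-⊑ : (a : Interaction n) → activateFiring a ⊑ a
activateFiring-⊑ a = record { ⊑-fir = refl ; ⊑-act = λ p∈ → p∈ ; ⊑-neg = λ p∈ → p∈ }

≤ᵢ-activateFiring : (a : Interaction n) → a ≤ᵢ activateFiring a
≤ᵢ-activateFiring a = record
  { fir-⊆ = λ p∈ → p∈
  ; act-⊆ = λ p∈ → x∈p∪q⁺ (inj₁ p∈)
  ; neg-⊆ = λ p∈ → p∈
  }

module _ {n : ℕ} where
  open CommutativeSemigroupProperties (∪ᵢ-commutativeSemigroup n)
  open CommutativeSemigroup (∪ᵢ-commutativeSemigroup n) using (assoc; comm)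

  ∪ᵢ-absorb : (a c : Interaction n) → a ∪ᵢ (a ∪ᵢ c) ≡ a ∪ᵢ c
  ∪ᵢ-absorb a c = trans (sym (assoc a a c)) (cong (_∪ᵢ c) (∪ᵢ-idem a))

  ∈⟦⟧-∪ᵢ : (t : Tree n) {b c : Interaction n} → b ∈⟦ t ⟧ → c ∈⟦ t ⟧ → (b ∪ᵢ c) ∈⟦ t ⟧
  ∈⟦⟧-∪ᵢ (leaf (just a)) (leaf refl) (leaf refl) = leaf (∪ᵢ-idem a)
  ∈⟦⟧-∪ᵢ (just a ⇒ t) (arr₁ refl) (arr₁ refl) = arr₁ (∪ᵢ-idem a)
  ∈⟦⟧-∪ᵢ (just a ⇒ t) (arr₁ refl) (arr₂ {c = c} refl c∈t refl) =
    arr₂ refl c∈t (∪ᵢ-absorb a c)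
  ∈⟦⟧-∪ᵢ (just a ⇒ t) (arr₂ {c = c} refl c∈t refl) (arr₁ refl) =
    arr₂ refl c∈t (trans (comm (a ∪ᵢ c) a) (∪ᵢ-absorb a c))
  ∈⟦⟧-∪ᵢ (just a ⇒ t) (arr₂ {c = c} refl c∈t refl) (arr₂ {c = c′} refl c′∈t refl) =
    arr₂ refl (∈⟦⟧-∪ᵢ t c∈t c′∈t)
      (trans (interchange a c a c′) (cong (_∪ᵢ (c ∪ᵢ c′)) (∪ᵢ-idem a)))
  ∈⟦⟧-∪ᵢ (t₁ ⊕ t₂) (plusˡ b∈t₁) (plusˡ c∈t₁) = plusˡ (∈⟦⟧-∪ᵢ t₁ b∈t₁ c∈t₁)
  ∈⟦⟧-∪ᵢ (t₁ ⊕ t₂) (plusʳ b∈t₂) (plusʳ c∈t₂) = plusʳ (∈⟦⟧-∪ᵢ t₂ b∈t₂ c∈t₂)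
  ∈⟦⟧-∪ᵢ (t₁ ⊕ t₂) (plusˡ b∈t₁) (plusʳ c∈t₂) = plus b∈t₁ c∈t₂ refl
  ∈⟦⟧-∪ᵢ (t₁ ⊕ t₂) {b} {c} (plusʳ b∈t₂) (plusˡ c∈t₁) = plus c∈t₁ b∈t₂ (comm b c)
  ∈⟦⟧-∪ᵢ (t₁ ⊕ t₂) {b} (plusˡ b∈t₁) (plus {b₁ = c₁} {c₂} c₁∈t₁ c₂∈t₂ refl) =
    plus (∈⟦⟧-∪ᵢ t₁ b∈t₁ c₁∈t₁) c₂∈t₂ (sym (assoc b c₁ c₂))
  ∈⟦⟧-∪ᵢ (t₁ ⊕ t₂) {b} (plusʳ b∈t₂) (plus {b₁ = c₁} {c₂} c₁∈t₁ c₂∈t₂ refl) =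
    plus c₁∈t₁ (∈⟦⟧-∪ᵢ t₂ b∈t₂ c₂∈t₂) (x∙yz≈y∙xz b c₁ c₂)
  ∈⟦⟧-∪ᵢ (t₁ ⊕ t₂) {c = c} (plus {b₁ = b₁} {b₂} b₁∈t₁ b₂∈t₂ refl) (plusˡ c∈t₁) =
    plus (∈⟦⟧-∪ᵢ t₁ b₁∈t₁ c∈t₁) b₂∈t₂ (xy∙z≈xz∙y b₁ b₂ c)
  ∈⟦⟧-∪ᵢ (t₁ ⊕ t₂) {c = c} (plus {b₁ = b₁} {b₂} b₁∈t₁ b₂∈t₂ refl) (plusʳ c∈t₂) =
    plus b₁∈t₁ (∈⟦⟧-∪ᵢ t₂ b₂∈t₂ c∈t₂) (assoc b₁ b₂ c)
  ∈⟦⟧-∪ᵢ (t₁ ⊕ t₂) (plus {b₁ = b₁} {b₂} b₁∈t₁ b₂∈t₂ refl)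
                   (plus {b₁ = c₁} {c₂} c₁∈t₁ c₂∈t₂ refl) =
    plus (∈⟦⟧-∪ᵢ t₁ b₁∈t₁ c₁∈t₁) (∈⟦⟧-∪ᵢ t₂ b₂∈t₂ c₂∈t₂) (interchange b₁ b₂ c₁ c₂)

  members : Tree n → List (Interaction n)
  members (leaf (just a)) = a ∷ []
  members (leaf nothing)  = []
  members (just a ⇒ t)    = a ∷ map (a ∪ᵢ_) (members t)
  members (nothing ⇒ t)   = []
  members (t₁ ⊕ t₂)       =
    members t₁ ++ members t₂ ++ cartesianProductWith _∪ᵢ_ (members t₁) (members t₂)

  ∈-members⁻ : (t : Tree n) {b : Interaction n} → b ∈ₗ members t → b ∈⟦ t ⟧
  ∈-members⁻ (leaf (just a)) (here refl) = leaf refl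
  ∈-members⁻ (just a ⇒ t) (here refl) = arr₁ refl
  ∈-members⁻ (just a ⇒ t) (there b∈) with ∈-map⁻ (a ∪ᵢ_) b∈
  ... | c , c∈ , refl = arr₂ refl (∈-members⁻ t c∈) refl
  ∈-members⁻ (t₁ ⊕ t₂) b∈ with ∈-++⁻ (members t₁) b∈
  ... | inj₁ b∈₁ = plusˡ (∈-members⁻ t₁ b∈₁)
  ... | inj₂ b∈′ with ∈-++⁻ (members t₂) b∈′
  ...   | inj₁ b∈₂ = plusʳ (∈-members⁻ t₂ b∈₂)
  ...   | inj₂ b∈₁₂ with ∈-cartesianProductWith⁻ _∪ᵢ_ (members t₁) (members t₂) b∈₁₂
  ...     | b₁ , b₂ , b₁∈ , b₂∈ , refl = plus (∈-members⁻ t₁ b₁∈) (∈-members⁻ t₂ b₂∈) refl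

  ∈-members⁺ : (t : Tree n) {b : Interaction n} → b ∈⟦ t ⟧ → b ∈ₗ members t
  ∈-members⁺ (leaf (just a)) (leaf refl) = here refl
  ∈-members⁺ (just a ⇒ t) (arr₁ refl) = here refl
  ∈-members⁺ (just a ⇒ t) (arr₂ refl c∈t refl) = there (∈-map⁺ (a ∪ᵢ_) (∈-members⁺ t c∈t))
  ∈-members⁺ (t₁ ⊕ t₂) (plusˡ b∈t₁) = ∈-++⁺ˡ (∈-members⁺ t₁ b∈t₁)
  ∈-members⁺ (t₁ ⊕ t₂) (plusʳ b∈t₂) = ∈-++⁺ʳ (members t₁) (∈-++⁺ˡ (∈-members⁺ t₂ b∈t₂))
  ∈-members⁺ (t₁ ⊕ t₂) (plus b₁∈t₁ b₂∈t₂ refl) =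
    ∈-++⁺ʳ (members t₁) (∈-++⁺ʳ (members t₂)
      (∈-cartesianProductWith⁺ _∪ᵢ_ (∈-members⁺ t₁ b₁∈t₁) (∈-members⁺ t₂ b₂∈t₂)))

literals : (Fin n → Literal n) → Subset n → List (Literal n)
literals lit s = map lit (filter (_∈? s) (allFin _))

module _ {lit : Fin n → Literal n} {s : Subset n} where

  ∈-literals⁺ : {q : Fin n} → q ∈ s → lit q ∈ₗ literals lit s
  ∈-literals⁺ {q} q∈s = ∈-map⁺ lit (∈-filter⁺ (_∈? s) (∈-allFin q) q∈s)

  ∈-literals⁻ : {l : Literal n} → l ∈ₗ literals lit s → ∃[ q ] q ∈ s × l ≡ lit q
  ∈-literals⁻ l∈ =
    let q , q∈ , l≡ = ∈-map⁻ lit l∈ in q , proj₂ (∈-filter⁻ (_∈? s) {xs = allFin n} q∈) , l≡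

  All-literals⁺ : {P : Literal n → Set} → (∀ {q} → q ∈ s → P (lit q)) → All P (literals lit s)
  All-literals⁺ {P} all = All.tabulate λ l∈ →
    let q , q∈s , l≡ = ∈-literals⁻ l∈ in subst P (sym l≡) (all q∈s)

  All-literals⁻ : {P : Literal n → Set} → All P (literals lit s) → ∀ {q} → q ∈ s → P (lit q)
  All-literals⁻ all q∈s = All.lookup all (∈-literals⁺ q∈s)

requirements : Interaction n → List (Literal n)
requirements a = literals fire (fir a) ++ literals actv (act a) ++ literals nega (neg a)

All-requirements⁺ : a ≤ᵢ b → All (Holds b) (requirements a)
All-requirements⁺ a≤b =
  ++⁺ (All-literals⁺ (fir-⊆ a≤b)) (++⁺ (All-literals⁺ (act-⊆ a≤b)) (All-literals⁺ (neg-⊆ a≤b)))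

All-requirements⁻ : All (Holds b) (requirements a) → a ≤ᵢ b
All-requirements⁻ {a = a} holds =
  let holds-fir , holds-act-neg = ++⁻ (literals fire (fir a)) holds
      holds-act , holds-neg = ++⁻ (literals actv (act a)) holds-act-neg
  in record { fir-⊆ = All-literals⁻ holds-fir
            ; act-⊆ = All-literals⁻ holds-act
            ; neg-⊆ = All-literals⁻ holds-neg
            }

requirements-avoid : {p : Fin n} → p ∉ fir a → All (_≢ fire p) (requirements a)
requirements-avoid {a = a} p∉a =
  ++⁺ (All-literals⁺ λ q∈a → λ { refl → p∉a q∈a })
      (++⁺ (All-literals⁺ λ _ ()) (All-literals⁺ λ _ ()))

above : List (Interaction n) → DNF n
above = map requirements

SatDNF-above⁺ : {as : List (Interaction n)} → a ∈ₗ as → a ≤ᵢ b → SatDNF b (above as)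
SatDNF-above⁺ a∈ a≤b = Any.map⁺ (lose a∈ (All-requirements⁺ a≤b))

SatDNF-above⁻ : {as : List (Interaction n)} → SatDNF b (above as) → ∃[ a ] a ∈ₗ as × a ≤ᵢ b
SatDNF-above⁻ sat =
  let a , a∈ , holds = find (Any.map⁻ sat) in a , a∈ , All-requirements⁻ holds

withoutFiring : Fin n → Interaction n → Interaction n
withoutFiring p a = record a { fir = fir a ∩ ∁ ⁅ p ⁆ }

∉-withoutFiring : (p : Fin n) (a : Interaction n) → p ∉ fir (withoutFiring p a)
∉-withoutFiring p a p∈ = x∈p⇒x∉∁p (x∈⁅x⁆ p) (proj₂ (x∈p∩q⁻ (fir a) _ p∈))

withoutFiring-≤ᵢ : {p : Fin n} → a ≤ᵢ b → withoutFiring p a ≤ᵢ b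
withoutFiring-≤ᵢ a≤b = record
  { fir-⊆ = λ q∈ → fir-⊆ a≤b (p∩q⊆p _ _ q∈)
  ; act-⊆ = act-⊆ a≤b
  ; neg-⊆ = neg-⊆ a≤b
  }

withoutFiring-≤ᵢ⁻ : {p : Fin n} → p ∈ fir b → withoutFiring p a ≤ᵢ b → a ≤ᵢ b
withoutFiring-≤ᵢ⁻ {b = b} {a} {p} p∈b a-p≤b = record
  { fir-⊆ = fir⊆
  ; act-⊆ = act-⊆ a-p≤b
  ; neg-⊆ = neg-⊆ a-p≤b
  }
  where
  fir⊆ : fir a ⊆ fir b
  fir⊆ {q} q∈a with q ≟ p
  ... | yes refl = p∈b
  ... | no q≢p   = fir-⊆ a-p≤b (x∈p∩q⁺ (q∈a , x∉p⇒x∈∁p (x≢y⇒x∉⁅y⁆ q≢p)))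

firingCause : Tree n → Fin n → DNF n
firingCause t p = above (map (withoutFiring p) (filter (λ a → p ∈? fir a) (members t)))

globalCause : Tree n → DNF n
globalCause t = above (members t)

module _ {n : ℕ} (t : Tree n) where

  firingCause-avoid : (p : Fin n) → DoesNotContain (fire p) (firingCause t p)
  firingCause-avoid p =
    All.map⁺ (All.map⁺ (All.universal (λ a → requirements-avoid (∉-withoutFiring p a)) _))

  firingCause⁺ : {p : Fin n} → a ∈⟦ t ⟧ → p ∈ fir a → a ≤ᵢ b → SatDNF b (firingCause t p)
  firingCause⁺ {p = p} a∈t p∈a a≤b =
    SatDNF-above⁺ (∈-map⁺ (withoutFiring p) (∈-filter⁺ (λ a → p ∈? fir a) (∈-members⁺ t a∈t) p∈a))
                  (withoutFiring-≤ᵢ a≤b)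

  firingCause⁻ : {p : Fin n} → p ∈ fir b → SatDNF b (firingCause t p) →
                 ∃[ a ] a ∈⟦ t ⟧ × a ≤ᵢ b × p ∈ fir a
  firingCause⁻ {p = p} p∈b sat =
    let a-p , a-p∈ , a-p≤b = SatDNF-above⁻ sat
        a , a∈ , a-p≡      = ∈-map⁻ (withoutFiring p) a-p∈
        a∈members , p∈a    = ∈-filter⁻ (λ a → p ∈? fir a) a∈
    in a , ∈-members⁻ t a∈members , withoutFiring-≤ᵢ⁻ p∈b (subst (_≤ᵢ _) a-p≡ a-p≤b) , p∈a

  globalCause⁺ : a ∈⟦ t ⟧ → a ≤ᵢ b → SatDNF b (globalCause t)
  globalCause⁺ a∈t = SatDNF-above⁺ (∈-members⁺ t a∈t)

  globalCause⁻ : SatDNF b (globalCause t) → ∃[ a ] a ∈⟦ t ⟧ × a ≤ᵢ b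
  globalCause⁻ sat = let a , a∈ , a≤b = SatDNF-above⁻ sat in a , ∈-members⁻ t a∈ , a≤b

  ruleSystem : InteractionSet n
  ruleSystem = γR (firingCause t) (globalCause t)

  ruleSystem-⊑ : ruleSystem b → ∃[ u ] u ∈⟦ t ⟧ × u ⊑ b
  ruleSystem-⊑ (firing-sat , global-sat , _) =
    let u , u∈t , u≤b , fir≡ = firingCover (∈⟦⟧-∪ᵢ t) (globalCause⁻ global-sat)
                                 (λ p∈b → firingCause⁻ p∈b (firing-sat _ p∈b))
    in u , u∈t , ≤ᵢ-⊑ u≤b fir≡

  ⟦⟧-⊑ : a ∈⟦ t ⟧ → ∃[ b ] ruleSystem b × b ⊑ a
  ⟦⟧-⊑ {a = a} a∈t =
    activateFiring a ,
    ( (λ p p∈a → firingCause⁺ a∈t p∈a (≤ᵢ-activateFiring a))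
    , globalCause⁺ a∈t (≤ᵢ-activateFiring a)
    , (λ p p∈a → x∈p∪q⁺ (inj₂ p∈a)) ) ,
    activateFiring-⊑ a

proposition4 : (n : ℕ) (t : Tree n) →
    Σ (Fin n → DNF n) λ Cf → Σ (DNF n) λ Ctt →
    (∀ p → DoesNotContain (fire p) (Cf p)) × (γR Cf Ctt ∼ ⟦ t ⟧)
proposition4 n t = firingCause t , globalCause t , firingCause-avoid t , ∼-⊑ (ruleSystem-⊑ t) (⟦⟧-⊑ t)
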